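{- Let $\Gamma=\langle\rho_0,\rho_1,\rho_2\rangle$ be an sggi with $\sigma_1=\rho_0\rho_1$, $\sigma_2=\rho_1\rho_2$, and let $N=\langle\sigma_1^m\rangle$ or $N=\langle\sigma_2^m\rangle$ (for some integer $m$) be a normal subgroup of $\Gamma$. If $\Gamma/N$ (with the images of $\rho_0,\rho_1,\rho_2$ as generators) is tight, then $\Gamma$ is tight.
   Context: An sggi (string group generated by involutions) of rank 3 is a group $\Gamma=\langle\rho_0,\rho_1,\rho_2\rangle$ with distinguished generators each of order 2 satisfying $(\rho_0\rho_2)^2=1$. With $\sigma_1=\rho_0\rho_1$ and $\sigma_2=\rho_1\rho_2$, the sggi is called tight if $\Gamma=\langle\sigma_1\rangle\langle\rho_1\rangle\langle\sigma_2\rangle$ (every element is a product $\sigma_1^a\rho_1^e\sigma_2^c$). -}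

module Defs where

open import Level using (Level; _⊔_)
open import Algebra.Bundles using (Group)
open import Data.Nat using (ℕ; zero; suc)
open import Data.Integer using (ℤ; +_; -[1+_])
open import Data.Product using (Σ; ∃; _×_; _,_)
open import Relation.Nullary using (¬_)

module _ {c ℓ : Level} (G : Group c ℓ) where
  open Group G

  powℕ : Carrier → ℕ → Carrier
  powℕ x zero    = ε
  powℕ x (suc n) = x ∙ powℕ x n

  pow : Carrier → ℤ → Carrier
  pow x (+ n)      = powℕ x n
  pow x -[1+ n ]   = (powℕ x (suc n)) ⁻¹

  data Gen3 (a b d : Carrier) : Carrier → Set (c ⊔ ℓ) where
    gen-ε   : Gen3 a b d ε
    gen-a   : Gen3 a b d a
    gen-b   : Gen3 a b d b
    gen-d   : Gen3 a b d d
    gen-∙   : ∀ {x y} → Gen3 a b d x → Gen3 a b d y → Gen3 a b d (x ∙ y)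
    gen-⁻¹  : ∀ {x} → Gen3 a b d x → Gen3 a b d (x ⁻¹)
    gen-≈   : ∀ {x y} → x ≈ y → Gen3 a b d x → Gen3 a b d y

  IsInvolution : Carrier → Set ℓ
  IsInvolution x = (x ∙ x ≈ ε) × ¬ (x ≈ ε)

  record IsSggi (ρ₀ ρ₁ ρ₂ : Carrier) : Set (c ⊔ ℓ) where
    field
      inv₀ : IsInvolution ρ₀
      inv₁ : IsInvolution ρ₁
      inv₂ : IsInvolution ρ₂
      string : (ρ₀ ∙ ρ₂) ∙ (ρ₀ ∙ ρ₂) ≈ ε
      generates : ∀ g → Gen3 ρ₀ ρ₁ ρ₂ g

  Cyclic : Carrier → Carrier → Set ℓ
  Cyclic x n = ∃ λ (k : ℤ) → n ≈ pow x k

  IsNormal : (Carrier → Set ℓ) → Set (c ⊔ ℓ)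
  IsNormal N = ∀ g n → N n → N ((g ∙ n) ∙ g ⁻¹)

  Tight : (ρ₀ ρ₁ ρ₂ : Carrier) → Set (c ⊔ ℓ)
  Tight ρ₀ ρ₁ ρ₂ = ∀ g → ∃ λ (a : ℤ) → ∃ λ (e : ℤ) → ∃ λ (k : ℤ) →
    g ≈ (pow (ρ₀ ∙ ρ₁) a ∙ pow ρ₁ e) ∙ pow (ρ₁ ∙ ρ₂) k

  -- Γ/N (generated by the images of ρ₀,ρ₁,ρ₂) is tight, for N normal:
  -- every coset gN equals the coset of some σ₁^a ρ₁^e σ₂^k, i.e.
  -- g ≈ σ₁^a ρ₁^e σ₂^k · n with n ∈ N.
  TightModulo : (Carrier → Set ℓ) → (ρ₀ ρ₁ ρ₂ : Carrier) → Set (c ⊔ ℓ)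
  TightModulo N ρ₀ ρ₁ ρ₂ = ∀ g → ∃ λ (a : ℤ) → ∃ λ (e : ℤ) → ∃ λ (k : ℤ) →
    ∃ λ (n : Carrier) → N n ×
      (g ≈ ((pow (ρ₀ ∙ ρ₁) a ∙ pow ρ₁ e) ∙ pow (ρ₁ ∙ ρ₂) k) ∙ n)

-- Tightness of Γ/N writes every g as σ₁ᵃ ρ₁ᵉ σ₂ᵏ n with n ∈ N = ⟨sᵐ⟩ ⊆ ⟨s⟩.  If s = σ₂, then
-- σ₂ᵏ n is again a power of σ₂.  If s = σ₁, move n to the left past h = ρ₁ᵉ σ₂ᵏ:
-- h n = (h n h⁻¹) h, where h n h⁻¹ ∈ N by normality, so σ₁ᵃ (h n h⁻¹) is a power of σ₁.
module Submission where

open import Defs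
open import Level using (Level)
open import Algebra.Bundles using (Group)
open import Data.Integer using (ℤ; +_; -[1+_])
open import Data.Nat using (zero; suc)
open import Data.Product using (_,_)
open import Data.Sum using (_⊎_; inj₁; inj₂)
import Algebra.Properties.Group as GroupProperties
import Relation.Binary.Reasoning.Setoid as SetoidReasoning

module _ {c ℓ : Level} (G : Group c ℓ) where
  open Group G
  open GroupProperties G
  open SetoidReasoning setoid

  powℕ-cong : ∀ {x y} n → x ≈ y → powℕ G x n ≈ powℕ G y n
  powℕ-cong zero    x≈y = refl
  powℕ-cong (suc n) x≈y = ∙-cong x≈y (powℕ-cong n x≈y)

  pow-cong : ∀ {x y} k → x ≈ y → pow G x k ≈ pow G y k
  pow-cong (+ n)    x≈y = powℕ-cong n x≈y
  pow-cong -[1+ n ] x≈y = ⁻¹-cong (powℕ-cong (suc n) x≈y)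

  powℕ-comm : ∀ x n → powℕ G x n ∙ x ≈ x ∙ powℕ G x n
  powℕ-comm x zero    = trans (identityˡ x) (sym (identityʳ x))
  powℕ-comm x (suc n) = trans (assoc _ _ _) (∙-congˡ (powℕ-comm x n))

  x∙[y∙x]⁻¹≈y⁻¹ : ∀ x y → x ∙ (y ∙ x) ⁻¹ ≈ y ⁻¹
  x∙[y∙x]⁻¹≈y⁻¹ x y = begin
    x ∙ (y ∙ x) ⁻¹        ≈⟨ ∙-congˡ (⁻¹-anti-homo-∙ y x) ⟩
    x ∙ (x ⁻¹ ∙ y ⁻¹)     ≈⟨ assoc _ _ _ ⟨
    (x ∙ x ⁻¹) ∙ y ⁻¹     ≈⟨ ∙-congʳ (inverseʳ x) ⟩
    ε ∙ y ⁻¹              ≈⟨ identityˡ _ ⟩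
    y ⁻¹                  ∎

  y∙x≈[y∙x∙y⁻¹]∙y : ∀ x y → y ∙ x ≈ ((y ∙ x) ∙ y ⁻¹) ∙ y
  y∙x≈[y∙x∙y⁻¹]∙y x y = begin
    y ∙ x                   ≈⟨ identityʳ _ ⟨
    (y ∙ x) ∙ ε             ≈⟨ ∙-congˡ (inverseˡ y) ⟨
    (y ∙ x) ∙ (y ⁻¹ ∙ y)    ≈⟨ assoc _ _ _ ⟨
    ((y ∙ x) ∙ y ⁻¹) ∙ y    ∎

  Cyclic-resp : ∀ {x y z} → y ≈ z → Cyclic G x y → Cyclic G x z
  Cyclic-resp y≈z (k , y≈xᵏ) = k , trans (sym y≈z) y≈xᵏ

  Cyclic-cong : ∀ {x y z} → x ≈ y → Cyclic G x z → Cyclic G y z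
  Cyclic-cong x≈y (k , z≈xᵏ) = k , trans z≈xᵏ (pow-cong k x≈y)

  Cyclic-ε : ∀ x → Cyclic G x ε
  Cyclic-ε x = + 0 , refl

  Cyclic-⁻¹ : ∀ {x y} → Cyclic G x y → Cyclic G x (y ⁻¹)
  Cyclic-⁻¹ {x} (+ zero , y≈ε) =
    Cyclic-resp (sym (trans (⁻¹-cong y≈ε) ε⁻¹≈ε)) (Cyclic-ε x)
  Cyclic-⁻¹ (+ suc n , y≈xⁿ⁺¹) = -[1+ n ] , ⁻¹-cong y≈xⁿ⁺¹
  Cyclic-⁻¹ (-[1+ n ] , y≈x⁻ⁿ⁻¹) = + suc n , trans (⁻¹-cong y≈x⁻ⁿ⁻¹) (⁻¹-involutive _)

  Cyclic-x∙ : ∀ {x y} → Cyclic G x y → Cyclic G x (x ∙ y)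
  Cyclic-x∙ (+ n , y≈xⁿ) = + suc n , ∙-congˡ y≈xⁿ
  Cyclic-x∙ {x} {y} (-[1+ n ] , y≈x⁻ⁿ⁻¹) = Cyclic-resp x⁻ⁿ≈x∙y (Cyclic-⁻¹ (+ n , refl))
    where
    x⁻ⁿ≈x∙y : powℕ G x n ⁻¹ ≈ x ∙ y
    x⁻ⁿ≈x∙y = begin
      powℕ G x n ⁻¹              ≈⟨ x∙[y∙x]⁻¹≈y⁻¹ x _ ⟨
      x ∙ (powℕ G x n ∙ x) ⁻¹    ≈⟨ ∙-congˡ (⁻¹-cong (powℕ-comm x n)) ⟩
      x ∙ (x ∙ powℕ G x n) ⁻¹    ≈⟨ ∙-congˡ y≈x⁻ⁿ⁻¹ ⟨
      x ∙ y                      ∎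

  Cyclic-x⁻¹∙ : ∀ {x y} → Cyclic G x y → Cyclic G x (x ⁻¹ ∙ y)
  Cyclic-x⁻¹∙ {x} {y} (+ zero , y≈ε) = -[1+ 0 ] , (begin
    x ⁻¹ ∙ y      ≈⟨ ∙-congˡ y≈ε ⟩
    x ⁻¹ ∙ ε      ≈⟨ identityʳ _ ⟩
    x ⁻¹          ≈⟨ ⁻¹-cong (identityʳ x) ⟨
    (x ∙ ε) ⁻¹    ∎)
  Cyclic-x⁻¹∙ {x} {y} (+ suc n , y≈xⁿ⁺¹) = + n , (begin
    x ⁻¹ ∙ y                    ≈⟨ ∙-congˡ y≈xⁿ⁺¹ ⟩
    x ⁻¹ ∙ (x ∙ powℕ G x n)     ≈⟨ assoc _ _ _ ⟨
    (x ⁻¹ ∙ x) ∙ powℕ G x n     ≈⟨ ∙-congʳ (inverseˡ x) ⟩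
    ε ∙ powℕ G x n              ≈⟨ identityˡ _ ⟩
    powℕ G x n                  ∎)
  Cyclic-x⁻¹∙ {x} {y} (-[1+ n ] , y≈x⁻ⁿ⁻¹) = -[1+ suc n ] , (begin
    x ⁻¹ ∙ y                          ≈⟨ ∙-congˡ y≈x⁻ⁿ⁻¹ ⟩
    x ⁻¹ ∙ (x ∙ powℕ G x n) ⁻¹        ≈⟨ ⁻¹-anti-homo-∙ _ _ ⟨
    ((x ∙ powℕ G x n) ∙ x) ⁻¹         ≈⟨ ⁻¹-cong (trans (assoc _ _ _) (∙-congˡ (powℕ-comm x n))) ⟩
    (x ∙ (x ∙ powℕ G x n)) ⁻¹         ∎)

  Cyclic-powℕ∙ : ∀ {x y} n → Cyclic G x y → Cyclic G x (powℕ G x n ∙ y)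
  Cyclic-powℕ∙ zero    y∈⟨x⟩ = Cyclic-resp (sym (identityˡ _)) y∈⟨x⟩
  Cyclic-powℕ∙ (suc n) y∈⟨x⟩ = Cyclic-resp (sym (assoc _ _ _)) (Cyclic-x∙ (Cyclic-powℕ∙ n y∈⟨x⟩))

  Cyclic-powℕ⁻¹∙ : ∀ {x y} n → Cyclic G x y → Cyclic G x (powℕ G x n ⁻¹ ∙ y)
  Cyclic-powℕ⁻¹∙ zero y∈⟨x⟩ =
    Cyclic-resp (sym (trans (∙-congʳ ε⁻¹≈ε) (identityˡ _))) y∈⟨x⟩
  Cyclic-powℕ⁻¹∙ {x} {y} (suc n) y∈⟨x⟩ =
    Cyclic-resp regroup (Cyclic-powℕ⁻¹∙ n (Cyclic-x⁻¹∙ y∈⟨x⟩))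
    where
    regroup : powℕ G x n ⁻¹ ∙ (x ⁻¹ ∙ y) ≈ (x ∙ powℕ G x n) ⁻¹ ∙ y
    regroup = begin
      powℕ G x n ⁻¹ ∙ (x ⁻¹ ∙ y)    ≈⟨ assoc _ _ _ ⟨
      (powℕ G x n ⁻¹ ∙ x ⁻¹) ∙ y    ≈⟨ ∙-congʳ (⁻¹-anti-homo-∙ _ _) ⟨
      (x ∙ powℕ G x n) ⁻¹ ∙ y       ∎

  Cyclic-pow∙ : ∀ {x y} k → Cyclic G x y → Cyclic G x (pow G x k ∙ y)
  Cyclic-pow∙ (+ n)    = Cyclic-powℕ∙ n
  Cyclic-pow∙ -[1+ n ] = Cyclic-powℕ⁻¹∙ (suc n)

  Cyclic-∙ : ∀ {x y z} → Cyclic G x y → Cyclic G x z → Cyclic G x (y ∙ z)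
  Cyclic-∙ (k , y≈xᵏ) z∈⟨x⟩ = Cyclic-resp (∙-congʳ (sym y≈xᵏ)) (Cyclic-pow∙ k z∈⟨x⟩)

  Cyclic-powℕ : ∀ {x y} n → Cyclic G x y → Cyclic G x (powℕ G y n)
  Cyclic-powℕ {x} zero    y∈⟨x⟩ = Cyclic-ε x
  Cyclic-powℕ     (suc n) y∈⟨x⟩ = Cyclic-∙ y∈⟨x⟩ (Cyclic-powℕ n y∈⟨x⟩)

  Cyclic-pow : ∀ {x y} k → Cyclic G x y → Cyclic G x (pow G y k)
  Cyclic-pow (+ n)    y∈⟨x⟩ = Cyclic-powℕ n y∈⟨x⟩
  Cyclic-pow -[1+ n ] y∈⟨x⟩ = Cyclic-⁻¹ (Cyclic-powℕ (suc n) y∈⟨x⟩)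

  Cyclic-pow⊆Cyclic : ∀ {x y} m → Cyclic G (pow G x m) y → Cyclic G x y
  Cyclic-pow⊆Cyclic m (k , y≈xᵐᵏ) = Cyclic-resp (sym y≈xᵐᵏ) (Cyclic-pow k (m , refl))

  module _ (N : Carrier → Set ℓ) (ρ₀ ρ₁ ρ₂ : Carrier) where

    tight-if-kernel⊆⟨σ₂⟩ : (∀ {n} → N n → Cyclic G (ρ₁ ∙ ρ₂) n) →
      TightModulo G N ρ₀ ρ₁ ρ₂ → Tight G ρ₀ ρ₁ ρ₂
    tight-if-kernel⊆⟨σ₂⟩ N⊆⟨σ₂⟩ tightModN g
      with a , e , k , n , n∈N , g≈σ₁ᵃρ₁ᵉσ₂ᵏn ← tightModN g
      with k′ , σ₂ᵏn≈σ₂ᵏ′ ← Cyclic-pow∙ k (N⊆⟨σ₂⟩ n∈N) =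
      a , e , k′ , (begin
        g                             ≈⟨ g≈σ₁ᵃρ₁ᵉσ₂ᵏn ⟩
        ((A ∙ R) ∙ K) ∙ n             ≈⟨ assoc _ _ _ ⟩
        (A ∙ R) ∙ (K ∙ n)             ≈⟨ ∙-congˡ σ₂ᵏn≈σ₂ᵏ′ ⟩
        (A ∙ R) ∙ pow G (ρ₁ ∙ ρ₂) k′  ∎)
      where
      A = pow G (ρ₀ ∙ ρ₁) a
      R = pow G ρ₁ e
      K = pow G (ρ₁ ∙ ρ₂) k

    tight-if-normal-kernel⊆⟨σ₁⟩ : IsNormal G N → (∀ {n} → N n → Cyclic G (ρ₀ ∙ ρ₁) n) →
      TightModulo G N ρ₀ ρ₁ ρ₂ → Tight G ρ₀ ρ₁ ρ₂
    tight-if-normal-kernel⊆⟨σ₁⟩ normal N⊆⟨σ₁⟩ tightModN g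
      with a , e , k , n , n∈N , g≈σ₁ᵃρ₁ᵉσ₂ᵏn ← tightModN g
      with a′ , σ₁ᵃhnh⁻¹≈σ₁ᵃ′ ← Cyclic-pow∙ a (N⊆⟨σ₁⟩ (normal (pow G ρ₁ e ∙ pow G (ρ₁ ∙ ρ₂) k) n n∈N)) =
      a′ , e , k , (begin
        g                             ≈⟨ g≈σ₁ᵃρ₁ᵉσ₂ᵏn ⟩
        ((A ∙ R) ∙ K) ∙ n             ≈⟨ trans (∙-congʳ (assoc _ _ _)) (assoc _ _ _) ⟩
        A ∙ (h ∙ n)                   ≈⟨ ∙-congˡ (y∙x≈[y∙x∙y⁻¹]∙y n h) ⟩
        A ∙ (((h ∙ n) ∙ h ⁻¹) ∙ h)    ≈⟨ assoc _ _ _ ⟨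
        (A ∙ ((h ∙ n) ∙ h ⁻¹)) ∙ h    ≈⟨ ∙-congʳ σ₁ᵃhnh⁻¹≈σ₁ᵃ′ ⟩
        pow G (ρ₀ ∙ ρ₁) a′ ∙ h        ≈⟨ assoc _ _ _ ⟨
        (pow G (ρ₀ ∙ ρ₁) a′ ∙ R) ∙ K  ∎)
      where
      A = pow G (ρ₀ ∙ ρ₁) a
      R = pow G ρ₁ e
      K = pow G (ρ₁ ∙ ρ₂) k
      h = R ∙ K

proposition2p5 : {c ℓ : Level} (G : Group c ℓ) (ρ₀ ρ₁ ρ₂ : Group.Carrier G) →
    IsSggi G ρ₀ ρ₁ ρ₂ →
    (m : ℤ) (s : Group.Carrier G) →
    (Group._≈_ G s (Group._∙_ G ρ₀ ρ₁) ⊎ Group._≈_ G s (Group._∙_ G ρ₁ ρ₂)) →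
    IsNormal G (Cyclic G (pow G s m)) →
    TightModulo G (Cyclic G (pow G s m)) ρ₀ ρ₁ ρ₂ →
    Tight G ρ₀ ρ₁ ρ₂
proposition2p5 G ρ₀ ρ₁ ρ₂ _ m s (inj₁ s≈σ₁) normal =
  tight-if-normal-kernel⊆⟨σ₁⟩ G _ ρ₀ ρ₁ ρ₂ normal
    (λ n∈N → Cyclic-cong G s≈σ₁ (Cyclic-pow⊆Cyclic G m n∈N))
proposition2p5 G ρ₀ ρ₁ ρ₂ _ m s (inj₂ s≈σ₂) _ =
  tight-if-kernel⊆⟨σ₂⟩ G _ ρ₀ ρ₁ ρ₂
    (λ n∈N → Cyclic-cong G s≈σ₂ (Cyclic-pow⊆Cyclic G m n∈N))
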